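{- Let $k$, $n$, $r$ be positive integers with $n\ge 2(k+r)$. Then $\gamma_k(n,r)\ge \gamma_k(n+1,r)$.
   Context: For integers $n\ge 2r\ge 2$, the Kneser graph $K(n,r)$ has as vertices the $r$-element subsets of $[n]=\{1,\dots,n\}$, two vertices being adjacent iff they are disjoint. For a graph $G$ and positive integer $k$, a set $D\subseteq V(G)$ is a $k$-dominating set if every vertex $u\in V(G)\setminus D$ has at least $k$ neighbors in $D$; the $k$-domination number $\gamma_k(G)$ is the minimum cardinality of a $k$-dominating set. Write $\gamma_k(n,r)=\gamma_k(K(n,r))$. -}

module Defs where

open import Data.Nat using (ℕ; _≤_)
open import Data.Bool using (Bool)
import Data.Bool.Properties as BoolP
open import Data.Vec.Properties using (≡-dec)
open import Data.Fin.Subset using (Subset; _∩_; ⊥; ∣_∣)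
open import Data.List using (List; length; filter)
open import Data.List.Relation.Unary.All using (All)
open import Data.List.Relation.Unary.Unique.Propositional using (Unique)
import Data.List.Membership.Propositional as LM
open import Data.Product using (Σ; _×_)
open import Relation.Binary.PropositionalEquality using (_≡_)
open import Relation.Nullary using (Dec; ¬_)

-- Vertices of the Kneser graph K(n,r): subsets of [n] (as Subset n) with exactly r elements.
IsVertex : (n r : ℕ) → Subset n → Set
IsVertex n r u = ∣ u ∣ ≡ r

-- Adjacency in K(n,r): disjointness.
Disjoint : {n : ℕ} → Subset n → Subset n → Set
Disjoint u v = u ∩ v ≡ ⊥

disjoint? : {n : ℕ} (u v : Subset n) → Dec (Disjoint u v)
disjoint? u v = ≡-dec BoolP._≟_ (u ∩ v) ⊥

nbrCount : {n : ℕ} → List (Subset n) → Subset n → ℕ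
nbrCount D u = length (filter (disjoint? u) D)

-- A set of vertices of K(n,r), represented as a duplicate-free list of r-subsets.
IsVertexSet : (n r : ℕ) → List (Subset n) → Set
IsVertexSet n r D = Unique D × All (IsVertex n r) D

IsKDominating : (k n r : ℕ) → List (Subset n) → Set
IsKDominating k n r D =
  IsVertexSet n r D ×
  ((u : Subset n) → IsVertex n r u → ¬ (u LM.∈ D) → k ≤ nbrCount D u)

IsKDominationNumber : (k n r m : ℕ) → Set
IsKDominationNumber k n r m =
  Σ (List (Subset n)) (λ D → IsKDominating k n r D × length D ≡ m) ×
  ((D : List (Subset n)) → IsKDominating k n r D → m ≤ length D)

-- A k-dominating set D of K(n,r) stays k-dominating in K(n+1,r) as soon as every
-- (r−1)-set u₀ has at least k neighbours in D, because the new vertices u₀ ∪ {n+1} have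
-- exactly the neighbours of u₀. A minimum D has this property. Otherwise some u₀ has fewer
-- than k neighbours, so every one-point extension u₀ ∪ {y} must itself lie in D. Choose a
-- (k+r)-set K avoiding u₀ (n ≥ 2(k+r) leaves room for it and for k+1 further points): the
-- at least k+1 extensions avoiding K can be exchanged for k distinct r-subsets of K. The
-- result is a smaller k-dominating set: r-sets missing K are dominated by the new sets,
-- r-sets meeting K and u₀ keep all their old neighbours, and r-sets meeting K but missing
-- u₀ are adjacent to the extensions of u₀ by the ≥ k points of K they miss.
module Submission where

open import Defs

module ListCounting where

  open import Data.Nat using (ℕ; suc; _+_; _≤_; _<_; z≤n; s≤s)
  open import Data.Nat.Properties
  open import Data.List using (List; []; _∷_; length; filter; applyUpTo; map)
  open import Data.List.Properties using (filter-none; length-applyUpTo)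
  import Data.List.Relation.Unary.All as All
  open import Data.List.Relation.Unary.Any using (here; there)
  open import Data.List.Relation.Unary.AllPairs using ([]; _∷_)
  open import Data.List.Relation.Unary.Unique.Propositional using (Unique)
  import Data.List.Relation.Unary.Unique.Propositional.Properties as Unique
  open import Data.List.Relation.Binary.Sublist.Propositional using (⊆-refl)
  open import Data.List.Relation.Binary.Sublist.Propositional.Properties using (filter⁺; length-mono-≤)
  open import Data.List.Membership.Propositional using (_∈_)
  open import Data.List.Membership.Propositional.Properties using (∈-filter⁻; ∈-applyUpTo⁻)
  open import Data.Product using (_,_)
  open import Relation.Binary.PropositionalEquality using (_≡_; _≢_; refl; sym; trans; cong)
  open import Relation.Binary.Definitions using (DecidableEquality)
  open import Relation.Nullary using (¬_; yes; no; contradiction)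
  open import Level using (Level)
  open import Relation.Unary using (Pred; Decidable)
  open import Relation.Unary.Properties using (∁?)

  private
    variable
      p q : Level

  module _ {A : Set} where

    length-filter-∁ : {P : Pred A p} (P? : Decidable P) (xs : List A) →
      length xs ≡ length (filter P? xs) + length (filter (∁? P?) xs)
    length-filter-∁ P? [] = refl
    length-filter-∁ P? (x ∷ xs) with P? x
    ... | yes _ = cong suc (length-filter-∁ P? xs)
    ... | no _ = trans (cong suc (length-filter-∁ P? xs)) (sym (+-suc _ _))

    length-filter-mono : {P : Pred A p} {Q : Pred A q} (P? : Decidable P) (Q? : Decidable Q) →
      (∀ {x} → P x → Q x) → (xs : List A) → length (filter P? xs) ≤ length (filter Q? xs)
    length-filter-mono P? Q? P⇒Q xs = length-mono-≤ (filter⁺ P? Q? (λ { refl → P⇒Q }) (⊆-refl {x = xs}))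

    length-filter-disjoint : {P : Pred A p} {Q : Pred A q} (P? : Decidable P) (Q? : Decidable Q) →
      (∀ {x} → P x → ¬ Q x) → (xs : List A) →
      length (filter P? xs) + length (filter Q? xs) ≤ length xs
    length-filter-disjoint P? Q? P⇒¬Q xs = begin
      length (filter P? xs) + length (filter Q? xs)
        ≤⟨ +-monoʳ-≤ (length (filter P? xs)) (length-filter-mono Q? (∁? P?) (λ q p → P⇒¬Q p q) xs) ⟩
      length (filter P? xs) + length (filter (∁? P?) xs) ≡⟨ sym (length-filter-∁ P? xs) ⟩
      length xs ∎
      where open ≤-Reasoning

    module _ (_≟_ : DecidableEquality A) where

      Unique⇒count≤1 : ∀ {x} {ys : List A} → Unique ys → length (filter (_≟ x) ys) ≤ 1
      Unique⇒count≤1 [] = z≤n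
      Unique⇒count≤1 {x} {y ∷ ys} (y∉ys ∷ u) with y ≟ x
      ... | yes refl rewrite filter-none (_≟ y) (All.map (λ y≢z z≡y → y≢z (sym z≡y)) y∉ys) = s≤s z≤n
      ... | no _ = Unique⇒count≤1 u

      Unique-⊆⇒length≤ : ∀ {ys xs : List A} → Unique ys → (∀ {y} → y ∈ ys → y ∈ xs) →
        length ys ≤ length xs
      Unique-⊆⇒length≤ {[]} _ _ = z≤n
      Unique-⊆⇒length≤ {y ∷ ys} {[]} _ ys⊆xs with ys⊆xs (here refl)
      ... | ()
      Unique-⊆⇒length≤ {ys} {x ∷ xs} u ys⊆xs = begin
        length ys ≡⟨ length-filter-∁ (_≟ x) ys ⟩
        length (filter (_≟ x) ys) + length (filter (∁? (_≟ x)) ys)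
          ≤⟨ +-mono-≤ (Unique⇒count≤1 u) (Unique-⊆⇒length≤ (Unique.filter⁺ _ u) rest⊆xs) ⟩
        suc (length xs) ∎
        where
        open ≤-Reasoning
        rest⊆xs : ∀ {y} → y ∈ filter (∁? (_≟ x)) ys → y ∈ xs
        rest⊆xs y∈ with ∈-filter⁻ (∁? (_≟ x)) y∈
        ... | y∈ys , y≢x with ys⊆xs y∈ys
        ...   | here y≡x = contradiction y≡x y≢x
        ...   | there y∈xs = y∈xs

      distinct-members⇒≤length : (f : ℕ → A) (m : ℕ) {xs : List A} →
        (∀ {i j} → i < j → j < m → f i ≢ f j) → (∀ {j} → j < m → f j ∈ xs) → m ≤ length xs
      distinct-members⇒≤length f m {xs} distinct f∈xs = begin
        m ≡⟨ sym (length-applyUpTo f m) ⟩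
        length (applyUpTo f m) ≤⟨ Unique-⊆⇒length≤ (Unique.applyUpTo⁺₁ f m distinct) image⊆xs ⟩
        length xs ∎
        where
        open ≤-Reasoning
        image⊆xs : ∀ {y} → y ∈ applyUpTo f m → y ∈ xs
        image⊆xs y∈ with ∈-applyUpTo⁻ f y∈
        ... | j , j<m , refl = f∈xs j<m

  module _ {A B : Set} {P : Pred A p} {Q : Pred B q} (P? : Decidable P) (Q? : Decidable Q) (f : B → A) where

    length-filter-map : (∀ {x} → P (f x) → Q x) → (∀ {x} → Q x → P (f x)) → (xs : List B) →
      length (filter P? (map f xs)) ≡ length (filter Q? xs)
    length-filter-map to from [] = refl
    length-filter-map to from (x ∷ xs) with P? (f x) | Q? x
    ... | yes _ | yes _ = cong suc (length-filter-map to from xs)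
    ... | no _ | no _ = length-filter-map to from xs
    ... | yes p | no ¬q = contradiction (to p) ¬q
    ... | no ¬p | yes q = contradiction (from q) ¬p

module SubsetAlgebra where

  open import Data.Nat using (ℕ; zero; suc; _+_; _≤_; _<_; z≤n; s≤s)
  open import Data.Nat.Properties
  open import Data.Bool using (true; false)
  open import Data.Vec using ([]; _∷_)
  open import Data.Vec.Properties using (∷-injectiveʳ)
  open import Data.Fin.Subset
  open import Data.Fin.Subset.Properties
  open import Data.Product using (_,_)
  open import Data.Sum using (inj₁; inj₂; [_,_])
  open import Relation.Binary.PropositionalEquality using (_≡_; refl; sym; trans; cong; subst; module ≡-Reasoning)
  open import Relation.Nullary using (yes; no; contradiction)

  private
    variable
      n : ℕ
      u v w : Subset n

  disjoint⇒∉ : ∀ {x} → Disjoint u v → x ∈ u → x ∉ v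
  disjoint⇒∉ u∩v≡⊥ x∈u x∈v = ∉⊥ (subst (_ ∈_) u∩v≡⊥ (x∈p∩q⁺ (x∈u , x∈v)))

  ∉⇒disjoint : (∀ {x} → x ∈ u → x ∉ v) → Disjoint u v
  ∉⇒disjoint {u = u} {v} u∌v = Empty-unique λ (_ , x∈u∩v) →
    let x∈u , x∈v = x∈p∩q⁻ u v x∈u∩v in u∌v x∈u x∈v

  disjoint-sym : Disjoint u v → Disjoint v u
  disjoint-sym u∩v≡⊥ = ∉⇒disjoint λ x∈v x∈u → disjoint⇒∉ u∩v≡⊥ x∈u x∈v

  disjoint-⊆ʳ : Disjoint u v → w ⊆ v → Disjoint u w
  disjoint-⊆ʳ u∩v≡⊥ w⊆v = ∉⇒disjoint λ x∈u x∈w → disjoint⇒∉ u∩v≡⊥ x∈u (w⊆v x∈w)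

  disjoint-⊆ˡ : Disjoint u v → w ⊆ u → Disjoint w v
  disjoint-⊆ˡ u∩v≡⊥ w⊆u = disjoint-sym (disjoint-⊆ʳ (disjoint-sym u∩v≡⊥) w⊆u)

  disjoint-∪ʳ : Disjoint u v → Disjoint u w → Disjoint u (v ∪ w)
  disjoint-∪ʳ {v = v} {w = w} u∩v≡⊥ u∩w≡⊥ = ∉⇒disjoint λ x∈u x∈v∪w →
    [ disjoint⇒∉ u∩v≡⊥ x∈u , disjoint⇒∉ u∩w≡⊥ x∈u ] (x∈p∪q⁻ v w x∈v∪w)

  disjoint-∪ˡ : Disjoint u w → Disjoint v w → Disjoint (u ∪ v) w
  disjoint-∪ˡ u∩w≡⊥ v∩w≡⊥ = disjoint-sym (disjoint-∪ʳ (disjoint-sym u∩w≡⊥) (disjoint-sym v∩w≡⊥))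

  ⊆∁⇒disjoint : u ⊆ ∁ v → Disjoint u v
  ⊆∁⇒disjoint u⊆∁v = ∉⇒disjoint λ x∈u → x∈∁p⇒x∉p (u⊆∁v x∈u)

  disjoint-⊆⇒≡⊥ : Disjoint u v → u ⊆ v → u ≡ ⊥
  disjoint-⊆⇒≡⊥ u∩v≡⊥ u⊆v = Empty-unique λ (_ , x∈u) → disjoint⇒∉ u∩v≡⊥ x∈u (u⊆v x∈u)

  ∪-cancelˡ : Disjoint u v → Disjoint u w → u ∪ v ≡ u ∪ w → v ≡ w
  ∪-cancelˡ {u = u} {v} {w} u∩v≡⊥ u∩w≡⊥ eq = ⊆-antisym (⊆-cancel u∩v≡⊥ eq) (⊆-cancel u∩w≡⊥ (sym eq))
    where
    ⊆-cancel : ∀ {a b : Subset _} → Disjoint u a → u ∪ a ≡ u ∪ b → a ⊆ b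
    ⊆-cancel {a} {b} u∩a≡⊥ eq x∈a with x∈p∪q⁻ u b (subst (_ ∈_) eq (q⊆p∪q u a x∈a))
    ... | inj₁ x∈u = contradiction x∈a (disjoint⇒∉ u∩a≡⊥ x∈u)
    ... | inj₂ x∈b = x∈b

  ∣p∪q∣+∣p∩q∣≡∣p∣+∣q∣ : ∀ (p q : Subset n) → ∣ p ∪ q ∣ + ∣ p ∩ q ∣ ≡ ∣ p ∣ + ∣ q ∣
  ∣p∪q∣+∣p∩q∣≡∣p∣+∣q∣ [] [] = refl
  ∣p∪q∣+∣p∩q∣≡∣p∣+∣q∣ (false ∷ p) (false ∷ q) = ∣p∪q∣+∣p∩q∣≡∣p∣+∣q∣ p q
  ∣p∪q∣+∣p∩q∣≡∣p∣+∣q∣ (true ∷ p) (false ∷ q) = cong suc (∣p∪q∣+∣p∩q∣≡∣p∣+∣q∣ p q)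
  ∣p∪q∣+∣p∩q∣≡∣p∣+∣q∣ (false ∷ p) (true ∷ q) =
    trans (cong suc (∣p∪q∣+∣p∩q∣≡∣p∣+∣q∣ p q)) (sym (+-suc ∣ p ∣ ∣ q ∣))
  ∣p∪q∣+∣p∩q∣≡∣p∣+∣q∣ (true ∷ p) (true ∷ q) = cong suc (begin
    ∣ p ∪ q ∣ + suc ∣ p ∩ q ∣ ≡⟨ +-suc ∣ p ∪ q ∣ ∣ p ∩ q ∣ ⟩
    suc (∣ p ∪ q ∣ + ∣ p ∩ q ∣) ≡⟨ cong suc (∣p∪q∣+∣p∩q∣≡∣p∣+∣q∣ p q) ⟩
    suc (∣ p ∣ + ∣ q ∣) ≡⟨ sym (+-suc ∣ p ∣ ∣ q ∣) ⟩
    ∣ p ∣ + suc ∣ q ∣ ∎)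
    where open ≡-Reasoning

  ∣p∪q∣≡∣p∣+∣q∣ : ∀ (p q : Subset n) → Disjoint p q → ∣ p ∪ q ∣ ≡ ∣ p ∣ + ∣ q ∣
  ∣p∪q∣≡∣p∣+∣q∣ {n} p q p∩q≡⊥ = begin
    ∣ p ∪ q ∣ ≡⟨ sym (+-identityʳ _) ⟩
    ∣ p ∪ q ∣ + 0 ≡⟨ cong (∣ p ∪ q ∣ +_) (sym (∣⊥∣≡0 n)) ⟩
    ∣ p ∪ q ∣ + ∣ ⊥ {n} ∣ ≡⟨ cong (λ s → ∣ p ∪ q ∣ + ∣ s ∣) (sym p∩q≡⊥) ⟩
    ∣ p ∪ q ∣ + ∣ p ∩ q ∣ ≡⟨ ∣p∪q∣+∣p∩q∣≡∣p∣+∣q∣ p q ⟩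
    ∣ p ∣ + ∣ q ∣ ∎
    where open ≡-Reasoning

  ∣p∪q∣≤∣p∣+∣q∣ : ∀ (p q : Subset n) → ∣ p ∪ q ∣ ≤ ∣ p ∣ + ∣ q ∣
  ∣p∪q∣≤∣p∣+∣q∣ p q = ≤-trans (m≤m+n ∣ p ∪ q ∣ ∣ p ∩ q ∣) (≤-reflexive (∣p∪q∣+∣p∩q∣≡∣p∣+∣q∣ p q))

  ∣p∣≤∣p∩∁q∣+∣q∣ : ∀ (p q : Subset n) → ∣ p ∣ ≤ ∣ p ∩ ∁ q ∣ + ∣ q ∣
  ∣p∣≤∣p∩∁q∣+∣q∣ p q = ≤-trans (p⊆q⇒∣p∣≤∣q∣ p⊆p∩∁q∪q) (∣p∪q∣≤∣p∣+∣q∣ (p ∩ ∁ q) q)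
    where
    p⊆p∩∁q∪q : p ⊆ p ∩ ∁ q ∪ q
    p⊆p∩∁q∪q {x} x∈p with x ∈? q
    ... | yes x∈q = q⊆p∪q (p ∩ ∁ q) q x∈q
    ... | no x∉q = p⊆p∪q q (x∈p∩q⁺ (x∈p , x∉p⇒x∈∁p x∉q))

  ∣∁p∣+∣p∣≡n : ∀ (p : Subset n) → ∣ ∁ p ∣ + ∣ p ∣ ≡ n
  ∣∁p∣+∣p∣≡n {n} p = trans (cong (_+ ∣ p ∣) (∣∁p∣≡n∸∣p∣ p)) (m∸n+n≡m (∣p∣≤n p))

  -- segment s c S consists of the elements of S whose rank within S lies in [s, s + c).
  segment : ℕ → ℕ → Subset n → Subset n
  segment s c [] = []
  segment s c (false ∷ S) = false ∷ segment s c S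
  segment zero zero (true ∷ S) = false ∷ segment zero zero S
  segment zero (suc c) (true ∷ S) = true ∷ segment zero c S
  segment (suc s) c (true ∷ S) = false ∷ segment s c S

  segment-⊆ : ∀ s c (S : Subset n) → segment s c S ⊆ S
  segment-⊆ s c [] ()
  segment-⊆ s c (false ∷ S) = out⊆ (segment-⊆ s c S)
  segment-⊆ zero zero (true ∷ S) = out⊆ (segment-⊆ zero zero S)
  segment-⊆ zero (suc c) (true ∷ S) = in⊆in (segment-⊆ zero c S)
  segment-⊆ (suc s) c (true ∷ S) = out⊆ (segment-⊆ s c S)

  ∣segment∣ : ∀ s c (S : Subset n) → s + c ≤ ∣ S ∣ → ∣ segment s c S ∣ ≡ c
  ∣segment∣ s c [] s+c≤0 = sym (n≤0⇒n≡0 (≤-trans (m≤n+m c s) s+c≤0))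
  ∣segment∣ s c (false ∷ S) s+c≤ = ∣segment∣ s c S s+c≤
  ∣segment∣ zero zero (true ∷ S) _ = ∣segment∣ zero zero S z≤n
  ∣segment∣ zero (suc c) (true ∷ S) (s≤s c≤) = cong suc (∣segment∣ zero c S c≤)
  ∣segment∣ (suc s) c (true ∷ S) (s≤s s+c≤) = ∣segment∣ s c S s+c≤

  segment-injective : ∀ {i j} c (S : Subset n) → i < ∣ S ∣ → j < ∣ S ∣ →
    segment i (suc c) S ≡ segment j (suc c) S → i ≡ j
  segment-injective c (false ∷ S) i< j< eq = segment-injective c S i< j< (∷-injectiveʳ eq)
  segment-injective {i = zero} {zero} c (true ∷ S) _ _ _ = refl
  segment-injective {i = suc i} {suc j} c (true ∷ S) (s≤s i<) (s≤s j<) eq =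
    cong suc (segment-injective c S i< j< (∷-injectiveʳ eq))

open ListCounting
open SubsetAlgebra
open import Data.Nat using (ℕ; suc; _+_; _*_; _≤_; _<_; _≥_; z≤n; s≤s; _≤?_)
open import Data.Nat.Properties
open import Data.Bool using (true; false)
import Data.Bool.Properties as Bool
open import Data.Vec using (_∷_)
open import Data.Vec.Properties using (≡-dec; ∷-injectiveʳ)
open import Data.Fin.Subset using (Subset; _⊆_; _∩_; _∪_; ∁; ∣_∣; outside)
open import Data.Fin.Subset.Properties using (_⊆?_; p⊆p∪q; q⊆p∪q; p∩q⊆p; p∩q⊆q; p⊆q⇒∁p⊇∁q; ∣⊥∣≡0)
open import Data.List using (List; length; filter; applyUpTo; _++_; map)
open import Data.List.Properties using (length-applyUpTo; length-++; length-map)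
open import Data.List.Relation.Unary.All as All using (All)
open import Data.List.Relation.Unary.Unique.Propositional using (Unique)
import Data.List.Relation.Unary.Unique.Propositional.Properties as Unique
open import Data.List.Membership.Propositional using (_∈_; _∉_)
open import Data.List.Membership.Propositional.Properties
  using (∈-filter⁻; ∈-filter⁺; ∈-applyUpTo⁺; ∈-applyUpTo⁻; ∈-++⁺ˡ; ∈-++⁺ʳ; ∈-++⁻; ∈-map⁺; ∈-map⁻)
open import Data.Product using (∃-syntax; _×_; _,_; proj₁; proj₂)
open import Data.Sum using (inj₁; inj₂)
open import Function using (_∘_)
open import Relation.Binary.PropositionalEquality using (_≡_; _≢_; refl; sym; trans; cong; cong₂; subst; module ≡-Reasoning)
open import Relation.Binary.Definitions using (DecidableEquality)
open import Relation.Nullary using (¬_; Dec; yes; no; ¬?; contradiction; _×-dec_)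

private
  variable
    n : ℕ

_≟ₛ_ : DecidableEquality (Subset n)
_≟ₛ_ = ≡-dec Bool._≟_

room-for-K : ∀ {k r f n} → f + r ≡ n → 2 * (k + suc r) ≤ n → k + suc r ≤ f
room-for-K {k} {r} {f} {n} f+r≡n large = +-cancelʳ-≤ r (k + suc r) f (begin
  k + suc r + r ≤⟨ +-monoʳ-≤ (k + suc r) (≤-trans (n≤1+n r) (m≤n+m (suc r) k)) ⟩
  k + suc r + (k + suc r) ≡⟨ cong (k + suc r +_) (sym (+-identityʳ (k + suc r))) ⟩
  2 * (k + suc r) ≤⟨ large ⟩
  n ≡⟨ sym f+r≡n ⟩
  f + r ∎)
  where open ≤-Reasoning

room-outside : ∀ {k r f n} → f + (r + (k + suc r)) ≡ n → 2 * (k + suc r) ≤ n → suc k ≤ f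
room-outside {k} {r} {f} {n} eq large = +-cancelʳ-≤ (r + (k + suc r)) (suc k) f (begin
  suc k + (r + (k + suc r)) ≡⟨ sym (+-assoc (suc k) r (k + suc r)) ⟩
  suc k + r + (k + suc r) ≡⟨ cong (_+ (k + suc r)) (sym (+-suc k r)) ⟩
  k + suc r + (k + suc r) ≡⟨ cong (k + suc r +_) (sym (+-identityʳ (k + suc r))) ⟩
  2 * (k + suc r) ≤⟨ large ⟩
  n ≡⟨ sym eq ⟩
  f + (r + (k + suc r)) ∎)
  where open ≤-Reasoning

nbrCount-antitone : ∀ (D : List (Subset n)) {u v} → u ⊆ v → nbrCount D v ≤ nbrCount D u
nbrCount-antitone D u⊆v =
  length-filter-mono (disjoint? _) (disjoint? _) (λ v∩d≡⊥ → disjoint-⊆ˡ v∩d≡⊥ u⊆v) D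

nbrCount-lift : ∀ b (u : Subset n) D → nbrCount (map (outside ∷_) D) (b ∷ u) ≡ nbrCount D u
nbrCount-lift b u D = length-filter-map (disjoint? (b ∷ u)) (disjoint? u) (outside ∷_)
  ∷-injectiveʳ (cong₂ _∷_ (Bool.∧-zeroʳ b)) D

module Exchange {k n r : ℕ} {D : List (Subset n)} (D-dom : IsKDominating k n (suc r) D)
  {u₀ : Subset n} (∣u₀∣≡r : ∣ u₀ ∣ ≡ r) (few : nbrCount D u₀ < k)
  (large : 2 * (k + suc r) ≤ n) where

  open import Data.List.Membership.DecPropositional (_≟ₛ_ {n}) using (_∈?_)

  D-unique : Unique D
  D-unique = proj₁ (proj₁ D-dom)

  D-vertices : All (IsVertex n (suc r)) D
  D-vertices = proj₂ (proj₁ D-dom)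

  D-dominates : ∀ u → IsVertex n (suc r) u → u ∉ D → k ≤ nbrCount D u
  D-dominates = proj₂ D-dom

  -- Outside D, u₀ ∪ y would need k neighbours in D, and these are neighbours of u₀.
  extension∈D : ∀ {y} → y ⊆ ∁ u₀ → ∣ y ∣ ≡ 1 → u₀ ∪ y ∈ D
  extension∈D {y} y⊆∁u₀ ∣y∣≡1 with (u₀ ∪ y) ∈? D
  ... | yes u₀∪y∈D = u₀∪y∈D
  ... | no u₀∪y∉D = contradiction
    (≤-trans (D-dominates (u₀ ∪ y) vertex u₀∪y∉D) (nbrCount-antitone D (p⊆p∪q y))) (<⇒≱ few)
    where
    vertex : ∣ u₀ ∪ y ∣ ≡ suc r
    vertex = begin
      ∣ u₀ ∪ y ∣ ≡⟨ ∣p∪q∣≡∣p∣+∣q∣ u₀ y (disjoint-sym (⊆∁⇒disjoint y⊆∁u₀)) ⟩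
      ∣ u₀ ∣ + ∣ y ∣ ≡⟨ cong₂ _+_ ∣u₀∣≡r ∣y∣≡1 ⟩
      r + 1 ≡⟨ +-comm r 1 ⟩
      suc r ∎
      where open ≡-Reasoning

  extensions-≤ : ∀ (S : Subset n) {m} {xs : List (Subset n)} → S ⊆ ∁ u₀ → m ≤ ∣ S ∣ →
    (∀ {y} → y ⊆ S → ∣ y ∣ ≡ 1 → u₀ ∪ y ∈ xs) → m ≤ length xs
  extensions-≤ S {m} {xs} S⊆∁u₀ m≤∣S∣ ext∈xs =
    distinct-members⇒≤length _≟ₛ_ (λ j → u₀ ∪ segment j 1 S) m distinct member
    where
    u₀∩segment≡⊥ : ∀ j → Disjoint u₀ (segment j 1 S)
    u₀∩segment≡⊥ j = disjoint-sym (⊆∁⇒disjoint (S⊆∁u₀ ∘ segment-⊆ j 1 S))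
    distinct : ∀ {i j} → i < j → j < m → u₀ ∪ segment i 1 S ≢ u₀ ∪ segment j 1 S
    distinct {i} {j} i<j j<m eq = <⇒≢ i<j (segment-injective 0 S
      (<-≤-trans (<-trans i<j j<m) m≤∣S∣) (<-≤-trans j<m m≤∣S∣)
      (∪-cancelˡ (u₀∩segment≡⊥ i) (u₀∩segment≡⊥ j) eq))
    member : ∀ {j} → j < m → u₀ ∪ segment j 1 S ∈ xs
    member {j} j<m = ext∈xs (segment-⊆ j 1 S)
      (∣segment∣ j 1 S (≤-trans (≤-reflexive (+-comm j 1)) (≤-trans j<m m≤∣S∣)))

  K : Subset n
  K = segment 0 (k + suc r) (∁ u₀)

  K⊆∁u₀ : K ⊆ ∁ u₀
  K⊆∁u₀ = segment-⊆ 0 (k + suc r) (∁ u₀)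

  u₀∩K≡⊥ : Disjoint u₀ K
  u₀∩K≡⊥ = disjoint-sym (⊆∁⇒disjoint K⊆∁u₀)

  ∣K∣ : ∣ K ∣ ≡ k + suc r
  ∣K∣ = ∣segment∣ 0 (k + suc r) (∁ u₀)
    (room-for-K (trans (cong (∣ ∁ u₀ ∣ +_) (sym ∣u₀∣≡r)) (∣∁p∣+∣p∣≡n u₀)) large)

  block : ℕ → Subset n
  block j = segment j (suc r) K

  blocks : List (Subset n)
  blocks = applyUpTo block k

  j<k⇒j<∣K∣ : ∀ {j} → j < k → j < ∣ K ∣
  j<k⇒j<∣K∣ {j} j<k = <-≤-trans j<k (≤-trans (m≤m+n k (suc r)) (≤-reflexive (sym ∣K∣)))

  ∣block∣ : ∀ {j} → j < k → ∣ block j ∣ ≡ suc r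
  ∣block∣ {j} j<k = ∣segment∣ j (suc r) K
    (≤-trans (+-monoˡ-≤ (suc r) (<⇒≤ j<k)) (≤-reflexive (sym ∣K∣)))

  blocks-distinct : ∀ {i j} → i < j → j < k → block i ≢ block j
  blocks-distinct i<j j<k eq =
    <⇒≢ i<j (segment-injective r K (j<k⇒j<∣K∣ (<-trans i<j j<k)) (j<k⇒j<∣K∣ j<k) eq)

  Removable : Subset n → Set
  Removable s = u₀ ⊆ s × Disjoint s K

  Kept : Subset n → Set
  Kept s = ¬ Removable s × s ∉ blocks

  removable? : ∀ s → Dec (Removable s)
  removable? s = u₀ ⊆? s ×-dec disjoint? s K

  kept? : ∀ s → Dec (Kept s)
  kept? s = ¬? (removable? s) ×-dec ¬? (s ∈? blocks)

  D′ : List (Subset n)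
  D′ = blocks ++ filter kept? D

  ∈D′ : ∀ {y} → y ∈ D → ¬ Removable y → y ∈ D′
  ∈D′ {y} y∈D y-kept with y ∈? blocks
  ... | yes y∈blocks = ∈-++⁺ˡ y∈blocks
  ... | no y∉blocks = ∈-++⁺ʳ blocks (∈-filter⁺ kept? y∈D (y-kept , y∉blocks))

  D′-unique : Unique D′
  D′-unique = Unique.++⁺ (Unique.applyUpTo⁺₁ block k blocks-distinct) (Unique.filter⁺ kept? D-unique)
    λ (y∈blocks , y∈kept) → proj₂ (proj₂ (∈-filter⁻ kept? {xs = D} y∈kept)) y∈blocks

  D′-vertices : All (IsVertex n (suc r)) D′
  D′-vertices = All.tabulate vertex
    where
    vertex : ∀ {y} → y ∈ D′ → ∣ y ∣ ≡ suc r
    vertex y∈D′ with ∈-++⁻ blocks y∈D′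
    ... | inj₁ y∈blocks with ∈-applyUpTo⁻ block y∈blocks
    ...   | _ , j<k , refl = ∣block∣ j<k
    vertex y∈D′ | inj₂ y∈kept = All.lookup D-vertices (proj₁ (∈-filter⁻ kept? {xs = D} y∈kept))

  dominated-avoiding-K : ∀ {w} → Disjoint w K → k ≤ nbrCount D′ w
  dominated-avoiding-K {w} w∩K≡⊥ = distinct-members⇒≤length _≟ₛ_ block k blocks-distinct
    λ j<k → ∈-filter⁺ (disjoint? w) (∈-++⁺ˡ (∈-applyUpTo⁺ block j<k))
      (disjoint-⊆ʳ w∩K≡⊥ (segment-⊆ _ (suc r) K))

  dominated-meeting-u₀ : ∀ {w} → IsVertex n (suc r) w → w ∉ D′ → ¬ Disjoint w K →
    ¬ Disjoint w u₀ → k ≤ nbrCount D′ w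
  dominated-meeting-u₀ {w} w-vertex w∉D′ w∩K≢⊥ w∩u₀≢⊥ =
    ≤-trans (D-dominates w w-vertex w∉D)
      (Unique-⊆⇒length≤ _≟ₛ_ (Unique.filter⁺ (disjoint? w) D-unique) neighbour∈)
    where
    w∉D : w ∉ D
    w∉D w∈D = w∉D′ (∈D′ w∈D (w∩K≢⊥ ∘ proj₂))
    neighbour∈ : ∀ {y} → y ∈ filter (disjoint? w) D → y ∈ filter (disjoint? w) D′
    neighbour∈ y∈ with ∈-filter⁻ (disjoint? w) y∈
    ... | y∈D , w∩y≡⊥ = ∈-filter⁺ (disjoint? w)
      (∈D′ y∈D λ (u₀⊆y , _) → w∩u₀≢⊥ (disjoint-⊆ʳ w∩y≡⊥ u₀⊆y)) w∩y≡⊥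

  -- w misses at least k points of K, and adding any of them to u₀ gives a neighbour of w.
  dominated-avoiding-u₀ : ∀ {w} → IsVertex n (suc r) w → Disjoint w u₀ → k ≤ nbrCount D′ w
  dominated-avoiding-u₀ {w} ∣w∣≡r+1 w∩u₀≡⊥ =
    extensions-≤ (K ∩ ∁ w) (K⊆∁u₀ ∘ p∩q⊆p K (∁ w)) k≤ neighbour∈
    where
    k≤ : k ≤ ∣ K ∩ ∁ w ∣
    k≤ = +-cancelʳ-≤ (suc r) k ∣ K ∩ ∁ w ∣ (begin
      k + suc r ≡⟨ sym ∣K∣ ⟩
      ∣ K ∣ ≤⟨ ∣p∣≤∣p∩∁q∣+∣q∣ K w ⟩
      ∣ K ∩ ∁ w ∣ + ∣ w ∣ ≡⟨ cong (∣ K ∩ ∁ w ∣ +_) ∣w∣≡r+1 ⟩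
      ∣ K ∩ ∁ w ∣ + suc r ∎)
      where open ≤-Reasoning
    neighbour∈ : ∀ {y} → y ⊆ K ∩ ∁ w → ∣ y ∣ ≡ 1 → u₀ ∪ y ∈ filter (disjoint? w) D′
    neighbour∈ {y} y⊆ ∣y∣≡1 = ∈-filter⁺ (disjoint? w)
      (∈D′ (extension∈D (K⊆∁u₀ ∘ y⊆K) ∣y∣≡1) not-removable)
      (disjoint-∪ʳ w∩u₀≡⊥ (disjoint-sym (⊆∁⇒disjoint (p∩q⊆q K (∁ w) ∘ y⊆))))
      where
      y⊆K : y ⊆ K
      y⊆K = p∩q⊆p K (∁ w) ∘ y⊆
      not-removable : ¬ Removable (u₀ ∪ y)
      not-removable (_ , u₀∪y∩K≡⊥) with disjoint-⊆⇒≡⊥ (disjoint-⊆ˡ u₀∪y∩K≡⊥ (q⊆p∪q u₀ y)) y⊆K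
      ... | refl = contradiction (trans (sym (∣⊥∣≡0 n)) ∣y∣≡1) λ ()

  D′-dominating : IsKDominating k n (suc r) D′
  D′-dominating = (D′-unique , D′-vertices) , dominated
    where
    dominated : ∀ w → IsVertex n (suc r) w → w ∉ D′ → k ≤ nbrCount D′ w
    dominated w w-vertex w∉D′ with disjoint? w K | disjoint? w u₀
    ... | yes w∩K≡⊥ | _ = dominated-avoiding-K w∩K≡⊥
    ... | no w∩K≢⊥ | no w∩u₀≢⊥ = dominated-meeting-u₀ w-vertex w∉D′ w∩K≢⊥ w∩u₀≢⊥
    ... | no _ | yes w∩u₀≡⊥ = dominated-avoiding-u₀ w-vertex w∩u₀≡⊥

  many-removable : suc k ≤ length (filter removable? D)
  many-removable = extensions-≤ (∁ (u₀ ∪ K)) (p⊆q⇒∁p⊇∁q (p⊆p∪q K)) room removable∈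
    where
    room : suc k ≤ ∣ ∁ (u₀ ∪ K) ∣
    room = room-outside (begin
      ∣ ∁ (u₀ ∪ K) ∣ + (r + (k + suc r)) ≡⟨ cong (∣ ∁ (u₀ ∪ K) ∣ +_) (sym (cong₂ _+_ ∣u₀∣≡r ∣K∣)) ⟩
      ∣ ∁ (u₀ ∪ K) ∣ + (∣ u₀ ∣ + ∣ K ∣) ≡⟨ cong (∣ ∁ (u₀ ∪ K) ∣ +_) (sym (∣p∪q∣≡∣p∣+∣q∣ u₀ K u₀∩K≡⊥)) ⟩
      ∣ ∁ (u₀ ∪ K) ∣ + ∣ u₀ ∪ K ∣ ≡⟨ ∣∁p∣+∣p∣≡n (u₀ ∪ K) ⟩
      n ∎) large
      where open ≡-Reasoning
    removable∈ : ∀ {y} → y ⊆ ∁ (u₀ ∪ K) → ∣ y ∣ ≡ 1 → u₀ ∪ y ∈ filter removable? D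
    removable∈ {y} y⊆ ∣y∣≡1 = ∈-filter⁺ removable?
      (extension∈D (p⊆q⇒∁p⊇∁q (p⊆p∪q K) ∘ y⊆) ∣y∣≡1)
      (p⊆p∪q y , disjoint-∪ˡ u₀∩K≡⊥ (disjoint-⊆ʳ (⊆∁⇒disjoint y⊆) (q⊆p∪q u₀ K)))

  D′-shorter : length D′ < length D
  D′-shorter = begin-strict
    length D′ ≡⟨ length-++ blocks ⟩
    length blocks + length (filter kept? D) ≡⟨ cong (_+ length (filter kept? D)) (length-applyUpTo block k) ⟩
    k + length (filter kept? D) <⟨ +-monoˡ-≤ (length (filter kept? D)) many-removable ⟩
    length (filter removable? D) + length (filter kept? D)
      ≤⟨ length-filter-disjoint removable? kept? (λ removable kept → proj₁ kept removable) D ⟩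
    length D ∎
    where open ≤-Reasoning

few-neighbours⇒shorter-dominating : ∀ {k n r} {D : List (Subset n)} {u₀ : Subset n} →
  IsKDominating k n (suc r) D → ∣ u₀ ∣ ≡ r → nbrCount D u₀ < k → 2 * (k + suc r) ≤ n →
  ∃[ D′ ] IsKDominating k n (suc r) D′ × length D′ < length D
few-neighbours⇒shorter-dominating D-dom ∣u₀∣≡r few large =
  D′ , D′-dominating , D′-shorter
  where open Exchange D-dom ∣u₀∣≡r few large

minimum⇒many-neighbours : ∀ {k n r} {D : List (Subset n)} →
  IsKDominating k n (suc r) D →
  (∀ D′ → IsKDominating k n (suc r) D′ → length D ≤ length D′) → 2 * (k + suc r) ≤ n →
  ∀ u → ∣ u ∣ ≡ r → k ≤ nbrCount D u
minimum⇒many-neighbours {k} {D = D} D-dom D-min large u ∣u∣≡r with k ≤? nbrCount D u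
... | yes k≤ = k≤
... | no k≰ with few-neighbours⇒shorter-dominating D-dom ∣u∣≡r (≰⇒> k≰) large
...   | D′ , D′-dom , D′-shorter = contradiction (D-min D′ D′-dom) (<⇒≱ D′-shorter)

lift-dominating : ∀ {k n r} {D : List (Subset n)} → IsKDominating k n (suc r) D →
  (∀ u → ∣ u ∣ ≡ r → k ≤ nbrCount D u) → IsKDominating k (suc n) (suc r) (map (outside ∷_) D)
lift-dominating {k} {D = D} ((D-unique , D-vertices) , D-dominates) many =
  (Unique.map⁺ ∷-injectiveʳ D-unique , All.tabulate vertex) , dominated
  where
  vertex : ∀ {y} → y ∈ map (outside ∷_) D → IsVertex _ _ y
  vertex y∈ with ∈-map⁻ (outside ∷_) y∈
  ... | _ , x∈D , refl = All.lookup D-vertices x∈D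
  dominated : ∀ u → IsVertex _ _ u → u ∉ map (outside ∷_) D → k ≤ nbrCount (map (outside ∷_) D) u
  dominated (false ∷ u) ∣u∣≡r+1 u∉ = subst (k ≤_) (sym (nbrCount-lift false u D))
    (D-dominates u ∣u∣≡r+1 (u∉ ∘ ∈-map⁺ (outside ∷_)))
  dominated (true ∷ u) ∣u∣+1≡r+1 _ = subst (k ≤_) (sym (nbrCount-lift true u D))
    (many u (suc-injective ∣u∣+1≡r+1))

mainTheorem3 : (k n r : ℕ) → 1 ≤ k → 1 ≤ r → 1 ≤ n → n ≥ 2 * (k + r) →
    (a b : ℕ) → IsKDominationNumber k n r a → IsKDominationNumber k (suc n) r b →
    a ≥ b
mainTheorem3 k n (suc r) _ (s≤s z≤n) _ large a b ((D , D-dom , ∣D∣≡a) , a-min) (_ , b-min) = begin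
  b ≤⟨ b-min _ (lift-dominating D-dom (minimum⇒many-neighbours D-dom D-min large)) ⟩
  length (map (outside ∷_) D) ≡⟨ length-map (outside ∷_) D ⟩
  length D ≡⟨ ∣D∣≡a ⟩
  a ∎
  where
  open ≤-Reasoning
  D-min : ∀ D′ → IsKDominating k n (suc r) D′ → length D ≤ length D′
  D-min D′ D′-dom = subst (_≤ length D′) (sym ∣D∣≡a) (a-min D′ D′-dom)
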